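{- Let $a,b,c$ be positive integers with $a>b$ and $a>c$. Then the pattern $[a\,b\,c\,a]$ is forbidden; that is, no path in any skip graph has four consecutive edges that are an $a$-arc, a $b$-arc, a $c$-arc and an $a$-arc in this order.
   Context: For a finite set $S$ of positive integers, the skip graph $G(S)$ has vertex set $\mathbb{N}=\{0,1,2,\dots\}$ and, for each $s\in S$ and $j\ge0$, an edge (an $s$-arc) between $2js$ and $(2j+1)s$. An unsigned pattern $[a_1\dots a_n]$ is realizable if there exist signs $\epsilon_k\in\{\pm1\}$ and an integer $T\ge0$ such that with $T_0=T$, $T_k=T_{k-1}+\epsilon_ka_k$, each $T_{k-1}$ is an even multiple of $a_k$ (0 included) when $\epsilon_k=+1$ and an odd multiple of $a_k$ when $\epsilon_k=-1$, and $T_0,\dots,T_n$ are pairwise distinct; equivalently some path with distinct vertices in some skip graph has consecutive edges that are arcs of sizes $a_1,\dots,a_n$. A pattern that is not realizable is forbidden. -}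

module Defs where

open import Data.Nat using (ℕ; zero; suc; _+_; _*_)
open import Data.Product using (∃; _×_)
open import Data.Sum using (_⊎_)
open import Data.List using (List; []; _∷_)
open import Data.List.Relation.Unary.Unique.Propositional using (Unique)
open import Relation.Binary.PropositionalEquality using (_≡_)
open import Data.Unit using (⊤)
open import Data.Empty using (⊥)
open import Relation.Nullary using (¬_)

-- Signed step of size a from x to y (vertices in ℕ):
--   ε = +1 : x is an even multiple of a (0 included), y = x + a
--   ε = -1 : x is an odd multiple of a,               y = x - a
Step : ℕ → ℕ → ℕ → Set
Step a x y =
  (∃ λ j → x ≡ (2 * j) * a × y ≡ x + a)
  ⊎ (∃ λ j → x ≡ (2 * j + 1) * a × y + a ≡ x)

Follows : List ℕ → List ℕ → Set
Follows []       (t ∷ [])       = ⊤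
Follows (a ∷ as) (t ∷ u ∷ ts)   = Step a t u × Follows as (u ∷ ts)
Follows _        _              = ⊥

Realizable : List ℕ → Set
Realizable p = ∃ λ (ts : List ℕ) → Follows p ts × Unique ts

Forbidden : List ℕ → Set
Forbidden p = ¬ Realizable p

-- Both a-arcs force T₁ and T₃ to be multiples of a, while |T₃ − T₁| is b + c or
-- |b − c|. In the second case T₁ = T₃, and in the first T₃ = T₁ + a with a = b + c;
-- reversing the path if necessary, the a-, b- and c-steps all go upwards. Then T₁ is
-- an odd multiple of b + c and an even multiple of b, while T₃ is an even multiple
-- of b + c and an odd multiple of c, which is impossible by parity.
module Submission where

open import Defs
open import Data.Nat using (ℕ; zero; suc; _+_; _*_; _/_; _<_; NonZero; >-nonZero)
open import Data.Nat.Properties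
open import Data.Nat.DivMod using (+-distrib-/-∣ˡ; m*n/n≡m; m<n⇒m/n≡0)
open import Data.Nat.Divisibility using (_∣_; divides; divides-refl; ∣m+n∣m⇒∣n)
open import Data.Nat.Tactic.RingSolver using (solve-∀)
open import Data.List using (_∷_; [])
open import Data.List.Relation.Unary.All using (_∷_)
open import Data.List.Relation.Unary.AllPairs using (_∷_)
open import Data.Product using (∃; _×_; _,_)
open import Data.Sum using (_⊎_; inj₁; inj₂; swap)
open import Data.Empty using (⊥)
open import Relation.Binary.PropositionalEquality
open import Relation.Nullary using (contradiction)
open import Algebra.Properties.CommutativeSemigroup +-commutativeSemigroup using (xy∙z≈xz∙y)

private
  variable
    a b c d e x y t₀ t₁ t₂ t₃ t₄ : ℕ

∣-+-cancel-< : a ∣ x → a ∣ y → d < a → e < a → x + d ≡ y + e → x ≡ y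
∣-+-cancel-< {a} (divides-refl u) (divides-refl w) d<a e<a eq =
  cong (_* a) (trans (sym (quotient u d<a)) (trans (cong (_/ a) eq) (quotient w e<a)))
  where
  instance
    a≢0 : NonZero a
    a≢0 = >-nonZero (m<n⇒0<n d<a)
  quotient : ∀ k {r} → r < a → (k * a + r) / a ≡ k
  quotient k {r} r<a = begin
    (k * a + r) / a      ≡⟨ +-distrib-/-∣ˡ r (divides-refl k) ⟩
    k * a / a + r / a    ≡⟨ cong₂ _+_ (m*n/n≡m k a) (m<n⇒m/n≡0 r<a) ⟩
    k + 0                ≡⟨ +-identityʳ k ⟩
    k                    ∎
    where open ≡-Reasoning

∣∧0<d<a+a⇒d≡a : a ∣ d → 0 < d → d < a + a → d ≡ a
∣∧0<d<a+a⇒d≡a (divides zero refl) ()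
∣∧0<d<a+a⇒d≡a {a} (divides (suc zero) refl) _ _ = +-identityʳ a
∣∧0<d<a+a⇒d≡a {a} (divides (suc (suc k)) refl) _ d<2a =
  contradiction (+-monoʳ-≤ a (m≤m+n a (k * a))) (<⇒≱ d<2a)

-- The 2-adic valuations would satisfy v(b) < v(b + c) < v(c), contradicting
-- v(b + c) ≥ min (v(b), v(c)). Avoiding valuations, the two equations combine
-- into (odd number) · (b + c) = (even number) · (b + c).
no-dyadic-split : ∀ p i j → 0 < b + c →
  (2 * p + 1) * (b + c) ≡ 2 * i * b → (2 * p + 2) * (b + c) ≡ (2 * j + 1) * c → ⊥
no-dyadic-split {b} {c} p i j 0<s e₁ e₂ =
  even≢odd (i * (2 * j + 1)) ((2 * j + 1) * p + j + i * (2 * p + 2)) (begin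
    2 * (i * (2 * j + 1))                                   ≡⟨ even-form i j ⟩
    2 * i * (2 * j + 1)                                     ≡⟨ *-cancelʳ-≡ _ _ (b + c) coefficients ⟨
    (2 * j + 1) * (2 * p + 1) + 2 * i * (2 * p + 2)         ≡⟨ odd-form p i j ⟩
    suc (2 * ((2 * j + 1) * p + j + i * (2 * p + 2)))       ∎)
  where
  open ≡-Reasoning
  instance
    s≢0 : NonZero (b + c)
    s≢0 = >-nonZero 0<s
  even-form : ∀ i j → 2 * (i * (2 * j + 1)) ≡ 2 * i * (2 * j + 1)
  even-form = solve-∀
  odd-form : ∀ p i j → (2 * j + 1) * (2 * p + 1) + 2 * i * (2 * p + 2)
                       ≡ suc (2 * ((2 * j + 1) * p + j + i * (2 * p + 2)))
  odd-form = solve-∀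
  split : ∀ p i j s → ((2 * j + 1) * (2 * p + 1) + 2 * i * (2 * p + 2)) * s
                      ≡ (2 * j + 1) * ((2 * p + 1) * s) + 2 * i * ((2 * p + 2) * s)
  split = solve-∀
  merge : ∀ i j b c → (2 * j + 1) * (2 * i * b) + 2 * i * ((2 * j + 1) * c)
                      ≡ 2 * i * (2 * j + 1) * (b + c)
  merge = solve-∀
  coefficients : ((2 * j + 1) * (2 * p + 1) + 2 * i * (2 * p + 2)) * (b + c)
                 ≡ 2 * i * (2 * j + 1) * (b + c)
  coefficients = begin
    ((2 * j + 1) * (2 * p + 1) + 2 * i * (2 * p + 2)) * (b + c)          ≡⟨ split p i j (b + c) ⟩
    (2 * j + 1) * ((2 * p + 1) * (b + c)) + 2 * i * ((2 * p + 2) * (b + c))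
      ≡⟨ cong₂ (λ u v → (2 * j + 1) * u + 2 * i * v) e₁ e₂ ⟩
    (2 * j + 1) * (2 * i * b) + 2 * i * ((2 * j + 1) * c)                 ≡⟨ merge i j b c ⟩
    2 * i * (2 * j + 1) * (b + c)                                         ∎

Up : ℕ → ℕ → ℕ → Set
Up a x y = ∃ λ j → x ≡ 2 * j * a × y ≡ x + a

Arc : ℕ → ℕ → ℕ → Set
Arc a x y = Up a x y ⊎ Up a y x

Step⇒Arc : Step a x y → Arc a x y
Step⇒Arc (inj₁ up) = inj₁ up
Step⇒Arc {a} {x} {y} (inj₂ (j , x≡ , y+a≡x)) = inj₂ (j , y≡ , sym y+a≡x)
  where
  odd-multiple : ∀ j a → (2 * j + 1) * a ≡ 2 * j * a + a
  odd-multiple = solve-∀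
  y≡ : y ≡ 2 * j * a
  y≡ = +-cancelʳ-≡ a y (2 * j * a) (trans y+a≡x (trans x≡ (odd-multiple j a)))

Up⇒∣ˡ : Up a x y → a ∣ x
Up⇒∣ˡ (j , x≡ , _) = divides (2 * j) x≡

Up⇒∣ʳ : Up a x y → a ∣ y
Up⇒∣ʳ {a} (j , x≡ , y≡) = divides (2 * j + 1) (trans y≡ (trans (cong (_+ a) x≡) (odd-end j a)))
  where
  odd-end : ∀ j a → 2 * j * a + a ≡ (2 * j + 1) * a
  odd-end = solve-∀

Arc⇒∣ʳ : Arc a x y → a ∣ y
Arc⇒∣ʳ (inj₁ up) = Up⇒∣ʳ up
Arc⇒∣ʳ (inj₂ up) = Up⇒∣ˡ up

Arc⇒∣ˡ : Arc a x y → a ∣ x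
Arc⇒∣ˡ arc = Arc⇒∣ʳ (swap arc)

no-up-up-up : 0 < b + c → Up (b + c) t₀ t₁ → Up b t₁ t₂ → Up c t₂ t₃ → ⊥
no-up-up-up {b} {c} 0<s (p , refl , refl) (i , e₁ , refl) (j , e₂ , refl) =
  no-dyadic-split p i j 0<s (trans (once p (b + c)) e₁) (begin
    (2 * p + 2) * (b + c)              ≡⟨ twice p b c ⟩
    2 * p * (b + c) + (b + c) + b + c  ≡⟨ cong (_+ c) e₂ ⟩
    2 * j * c + c                      ≡⟨ odd-end j c ⟩
    (2 * j + 1) * c                    ∎)
  where
  open ≡-Reasoning
  once : ∀ p s → (2 * p + 1) * s ≡ 2 * p * s + s
  once = solve-∀
  twice : ∀ p b c → (2 * p + 2) * (b + c) ≡ 2 * p * (b + c) + (b + c) + b + c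
  twice = solve-∀
  odd-end : ∀ j c → 2 * j * c + c ≡ (2 * j + 1) * c
  odd-end = solve-∀

-- Here a = b + c, so T₁ is the upper end of its a-arc: otherwise T₀ = T₁ + a = T₃.
no-forward-abca : 0 < b → b < a → c < a → Arc a t₀ t₁ → Up b t₁ t₂ → Up c t₂ t₃ →
  a ∣ t₃ → t₀ ≢ t₃ → ⊥
no-forward-abca {b} {a} {c} {t₀} {t₁} {t₃ = t₃}
                0<b b<a c<a arc ub@(_ , _ , refl) uc@(_ , _ , refl) a∣t₃ t₀≢t₃ =
  from-arc arc
  where
  open ≡-Reasoning
  0<s : 0 < b + c
  0<s = ≤-trans 0<b (m≤m+n b c)
  b+c≡a : b + c ≡ a
  b+c≡a = ∣∧0<d<a+a⇒d≡a (∣m+n∣m⇒∣n (subst (a ∣_) (+-assoc t₁ b c) a∣t₃) (Arc⇒∣ʳ arc))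
                     0<s (+-mono-< b<a c<a)
  from-arc : Arc a t₀ t₁ → ⊥
  from-arc (inj₁ up) =
    no-up-up-up {b} {c} 0<s (subst (λ a → Up a t₀ t₁) (sym b+c≡a) up) ub uc
  from-arc (inj₂ (_ , _ , t₀≡t₁+a)) = t₀≢t₃ (begin
    t₀           ≡⟨ t₀≡t₁+a ⟩
    t₁ + a       ≡⟨ cong (t₁ +_) b+c≡a ⟨
    t₁ + (b + c) ≡⟨ +-assoc t₁ b c ⟨
    t₃           ∎)

no-abca-arcs : 0 < b → 0 < c → b < a → c < a →
  Arc a t₀ t₁ → Arc b t₁ t₂ → Arc c t₂ t₃ → Arc a t₃ t₄ →
  t₀ ≢ t₃ → t₁ ≢ t₃ → t₁ ≢ t₄ → ⊥
no-abca-arcs 0<b 0<c b<a c<a a₀₁ (inj₁ ub) (inj₁ uc) a₃₄ t₀≢t₃ _ _ =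
  no-forward-abca 0<b b<a c<a a₀₁ ub uc (Arc⇒∣ˡ a₃₄) t₀≢t₃
no-abca-arcs 0<b 0<c b<a c<a a₀₁ (inj₂ ub) (inj₂ uc) a₃₄ _ _ t₁≢t₄ =
  no-forward-abca 0<c c<a b<a (swap a₃₄) uc ub (Arc⇒∣ʳ a₀₁) (≢-sym t₁≢t₄)
no-abca-arcs 0<b 0<c b<a c<a
             a₀₁ (inj₁ (_ , _ , t₂≡t₁+b)) (inj₂ (_ , _ , t₂≡t₃+c)) a₃₄ _ t₁≢t₃ _ =
  t₁≢t₃ (∣-+-cancel-< (Arc⇒∣ʳ a₀₁) (Arc⇒∣ˡ a₃₄) b<a c<a (trans (sym t₂≡t₁+b) t₂≡t₃+c))
no-abca-arcs {b} {c} {t₂ = t₂} 0<b 0<c b<a c<a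
             a₀₁ (inj₂ (_ , _ , refl)) (inj₁ (_ , _ , refl)) a₃₄ _ t₁≢t₃ _ =
  t₁≢t₃ (∣-+-cancel-< (Arc⇒∣ʳ a₀₁) (Arc⇒∣ˡ a₃₄) c<a b<a (xy∙z≈xz∙y t₂ b c))

claim12 : (a b c : ℕ) → 0 < b → 0 < c → b < a → c < a →
    Forbidden (a ∷ b ∷ c ∷ a ∷ [])
claim12 a b c 0<b 0<c b<a c<a
  (_ ∷ _ ∷ _ ∷ _ ∷ _ ∷ [] , (s₁ , s₂ , s₃ , s₄ , _) , (_ ∷ _ ∷ t₀≢t₃ ∷ _) ∷ (_ ∷ t₁≢t₃ ∷ t₁≢t₄ ∷ _) ∷ _) =
  no-abca-arcs 0<b 0<c b<a c<a (Step⇒Arc s₁) (Step⇒Arc s₂) (Step⇒Arc s₃) (Step⇒Arc s₄) t₀≢t₃ t₁≢t₃ t₁≢t₄
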